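{- Let $(B,A\cup\{\alpha\})$ be an admissible order-domain. If $\mathsf{Match\_Ask}(B,A,\alpha)=(\hat B,\hat A,M)$ and $(B,A)$ is not matchable, then $(\hat B,\hat A)$ is not matchable.
   Context: An order is a 4-tuple $\omega=(\mathsf{id}(\omega),\mathsf{timestamp}(\omega),\mathsf{qty}(\omega),\mathsf{price}(\omega))$ of natural numbers with $\mathsf{qty}(\omega)>0$. An order-domain $(B,A)$ is a pair of finite sets of orders (bids, asks); it is admissible if all orders in $B\cup A$ have pairwise distinct ids and pairwise distinct timestamps. Bid $b$ and ask $a$ are tradable if $\mathsf{price}(b)\ge\mathsf{price}(a)$; $(B,A)$ is matchable if some $b\in B,a\in A$ are tradable. Bid $b_1$ is more competitive than $b_2$ iff $\mathsf{price}(b_1)>\mathsf{price}(b_2)$, or prices equal and $\mathsf{timestamp}(b_1)<\mathsf{timestamp}(b_2)$. A transaction is a triple $(id_b,id_a,q)$ with $q>0$. $\mathsf{Match\_Ask}(B,A,\alpha)$: if $B=\emptyset$ return $(B,A\cup\{\alpha\},\emptyset)$. Otherwise let $\beta$ be the most competitive bid in $B$. If $\beta,\alpha$ not tradable, return $(B,A\cup\{\alpha\},\emptyset)$. If $\mathsf{qty}(\beta)=\mathsf{qty}(\alpha)$, return $(B\setminus\{\beta\},A,\{(\mathsf{id}(\beta),\mathsf{id}(\alpha),\mathsf{qty}(\alpha))\})$. If $\mathsf{qty}(\beta)>\mathsf{qty}(\alpha)$, return $((B\setminus\{\beta\})\cup\{\beta'\},A,\{(\mathsf{id}(\beta),\mathsf{id}(\alpha),\mathsf{qty}(\alpha))\})$,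 where $\beta'$ equals $\beta$ except $\mathsf{qty}(\beta')=\mathsf{qty}(\beta)-\mathsf{qty}(\alpha)$. If $\mathsf{qty}(\beta)<\mathsf{qty}(\alpha)$, let $\alpha'$ equal $\alpha$ except $\mathsf{qty}(\alpha')=\mathsf{qty}(\alpha)-\mathsf{qty}(\beta)$, compute $(B'',A'',M'')=\mathsf{Match\_Ask}(B\setminus\{\beta\},A,\alpha')$ and return $(B'',A'',M''\cup\{(\mathsf{id}(\beta),\mathsf{id}(\alpha),\mathsf{qty}(\beta))\})$. -}

module Defs where

open import Data.Nat using (ℕ; zero; suc; _≤_; _<_; _∸_; _≟_; _<?_; _≤?_)
open import Data.Nat.Properties using (<-cmp)
open import Data.Product using (_×_; _,_; ∃-syntax)
open import Data.List using (List; []; _∷_; _++_; filter; length)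
open import Data.List.Membership.Propositional using (_∈_)
open import Data.List.Relation.Unary.All using (All)
open import Data.List.Relation.Unary.AllPairs using (AllPairs)
open import Data.Bool using (Bool; true; false; _∨_; _∧_)
open import Relation.Nullary using (¬_; Dec; yes; no; ¬?)
open import Relation.Nullary.Decidable using (⌊_⌋; _×-dec_)
open import Relation.Binary.PropositionalEquality using (_≡_; _≢_; refl; cong)
open import Relation.Binary using (tri<; tri≈; tri>)

-- An order (id, timestamp, qty, price).  Positivity of qty is imposed as a
-- hypothesis on the orders under consideration (see lemmaA1).
record Order : Set where
  constructor order
  field
    id        : ℕ
    timestamp : ℕ
    qty       : ℕ
    price     : ℕ
open Order public

_≟ₒ_ : (o p : Order) → Dec (o ≡ p)
order a b c d ≟ₒ order a' b' c' d' with a ≟ a' | b ≟ b' | c ≟ c' | d ≟ d'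
... | yes refl | yes refl | yes refl | yes refl = yes refl
... | no ne | _ | _ | _ = no λ { refl → ne refl }
... | yes _ | no ne | _ | _ = no λ { refl → ne refl }
... | yes _ | yes _ | no ne | _ = no λ { refl → ne refl }
... | yes _ | yes _ | yes _ | no ne = no λ { refl → ne refl }

OrderSet : Set
OrderSet = List Order

-- transaction (id_b, id_a, q)
Transaction : Set
Transaction = ℕ × ℕ × ℕ

Admissible : OrderSet → OrderSet → Set
Admissible B A =
  AllPairs (λ o p → id o ≢ id p × timestamp o ≢ timestamp p) (B ++ A)

Tradable : Order → Order → Set
Tradable b a = price a ≤ price b

Matchable : OrderSet → OrderSet → Set
Matchable B A = ∃[ b ] ∃[ a ] (b ∈ B × a ∈ A × Tradable b a)

moreCompetitive : Order → Order → Bool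
moreCompetitive b₁ b₂ =
  ⌊ price b₂ <? price b₁ ⌋ ∨
  (⌊ price b₁ ≟ price b₂ ⌋ ∧ ⌊ timestamp b₁ <? timestamp b₂ ⌋)

best : Order → List Order → Order
best x [] = x
best x (y ∷ ys) with moreCompetitive y x
... | true  = best y ys
... | false = best x ys

remove : Order → OrderSet → OrderSet
remove β = filter (λ o → ¬? (o ≟ₒ β))

-- Match_Ask, with fuel bounding the recursion depth (each recursive call
-- removes a bid, so fuel = |B| suffices).
matchAsk′ : ℕ → OrderSet → OrderSet → Order → OrderSet × OrderSet × List Transaction
matchAsk′ _ [] A α = [] , α ∷ A , []
matchAsk′ zero B A α = B , α ∷ A , []   -- unreachable with sufficient fuel
matchAsk′ (suc n) (x ∷ xs) A α with best x xs
... | β with price α ≤? price β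
...   | no _ = x ∷ xs , α ∷ A , []
...   | yes _ with <-cmp (qty β) (qty α)
...     | tri≈ _ _ _ = remove β (x ∷ xs) , A , (id β , id α , qty α) ∷ []
...     | tri> _ _ _ =
          record β { qty = qty β ∸ qty α } ∷ remove β (x ∷ xs) , A ,
          (id β , id α , qty α) ∷ []
...     | tri< _ _ _ with matchAsk′ n (remove β (x ∷ xs)) A
                            (record α { qty = qty α ∸ qty β })
...       | B″ , A″ , M″ = B″ , A″ , (id β , id α , qty β) ∷ M″

matchAsk : OrderSet → OrderSet → Order → OrderSet × OrderSet × List Transaction
matchAsk B A α = matchAsk′ (length B) B A α

{-# OPTIONS --safe #-}
module Submission where

-- The bid β that α is matched against has the highest price in B.  So if α
-- is not tradable with β it is tradable with no bid, and adding it to the asks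
-- creates no match; otherwise every bid left over is either an old bid or β
-- with reduced quantity but unchanged price, and none of these was tradable
-- with any ask of A.  The recursive call starts from a subset of B and the
-- same A, so the argument repeats.

open import Defs
open import Data.Bool using (true; false)
open import Data.List using (List; []; _∷_; _++_; length)
open import Data.List.Membership.Propositional using (_∈_)
open import Data.List.Membership.Propositional.Properties using (∈-filter⁻)
open import Data.List.Properties using (filter-notAll)
open import Data.List.Relation.Unary.All using (All)
open import Data.List.Relation.Unary.Any using (here; there)
import Data.List.Relation.Unary.Any as Any
open import Data.Nat using (zero; suc; _>_; _≤_; _<_; _∸_; s≤s; _<?_; _≟_; _≤?_)
open import Data.Nat.Properties using (<-cmp; ≤-trans; ≤-refl; ≤-reflexive; <⇒≤; ≮⇒≥; ≤-pred)
open import Data.Product using (_×_; _,_; ∃-syntax; proj₁)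
open import Function using (_∘_)
open import Relation.Nullary using (¬_; yes; no; ¬?)
open import Relation.Binary using (tri<; tri≈; tri>)
open import Relation.Binary.PropositionalEquality using (_≡_; refl; sym; subst)

private
  variable
    A B B′ : OrderSet
    α β : Order

moreCompetitive⇒price≥ : ∀ b₁ b₂ → moreCompetitive b₁ b₂ ≡ true → price b₂ ≤ price b₁
moreCompetitive⇒price≥ b₁ b₂ mc with price b₂ <? price b₁
... | yes p₂<p₁ = <⇒≤ p₂<p₁
... | no _ with price b₁ ≟ price b₂
...   | yes p₁≡p₂ = ≤-reflexive (sym p₁≡p₂)
...   | no _ with mc
...     | ()

¬moreCompetitive⇒price≤ : ∀ b₁ b₂ → moreCompetitive b₁ b₂ ≡ false → price b₁ ≤ price b₂
¬moreCompetitive⇒price≤ b₁ b₂ mc with price b₂ <? price b₁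
... | yes _ with mc
...   | ()
¬moreCompetitive⇒price≤ b₁ b₂ mc | no p₂≮p₁ = ≮⇒≥ p₂≮p₁

best-∈ : ∀ x xs → best x xs ∈ x ∷ xs
best-∈ x [] = here refl
best-∈ x (y ∷ ys) with moreCompetitive y x
... | true = there (best-∈ y ys)
... | false with best-∈ x ys
...   | here  eq = here eq
...   | there m  = there (there m)

best-maximal : ∀ x xs {b} → b ∈ x ∷ xs → price b ≤ price (best x xs)
best-maximal x [] (here refl) = ≤-refl
best-maximal x (y ∷ ys) b∈ with moreCompetitive y x in mc
best-maximal x (y ∷ ys) (here refl)         | true  =
  ≤-trans (moreCompetitive⇒price≥ y x mc) (best-maximal y ys (here refl))
best-maximal x (y ∷ ys) (there b∈)          | true  = best-maximal y ys b∈
best-maximal x (y ∷ ys) (here refl)         | false = best-maximal x ys (here refl)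
best-maximal x (y ∷ ys) (there (here refl)) | false =
  ≤-trans (¬moreCompetitive⇒price≤ y x mc) (best-maximal x ys (here refl))
best-maximal x (y ∷ ys) (there (there b∈))  | false = best-maximal x ys (there b∈)

∈-remove⁻ : ∀ {o} B → o ∈ remove β B → o ∈ B
∈-remove⁻ {β = β} _ = proj₁ ∘ ∈-filter⁻ (λ o → ¬? (o ≟ₒ β))

length-remove< : ∀ B → β ∈ B → length (remove β B) < length B
length-remove< {β = β} B β∈ =
  filter-notAll (λ o → ¬? (o ≟ₒ β)) B (Any.map (λ β≡o o≢β → o≢β (sym β≡o)) β∈)

PriceDominated : OrderSet → OrderSet → Set
PriceDominated B′ B = ∀ {b′} → b′ ∈ B′ → ∃[ b ] (b ∈ B × price b′ ≤ price b)

Matchable-dominated : PriceDominated B′ B → Matchable B′ A → Matchable B A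
Matchable-dominated dom (b′ , a , b′∈ , a∈ , pa≤pb′) with dom b′∈
... | b , b∈ , pb′≤pb = b , a , b∈ , a∈ , ≤-trans pa≤pb′ pb′≤pb

remove-dominated : ∀ B → PriceDominated (remove β B) B
remove-dominated B b∈ = _ , ∈-remove⁻ B b∈ , ≤-refl

partialFill-dominated : ∀ B q → β ∈ B → PriceDominated (record β { qty = q } ∷ remove β B) B
partialFill-dominated B q β∈ (here refl) = _ , β∈ , ≤-refl
partialFill-dominated B q β∈ (there b∈)  = remove-dominated B b∈

¬Matchable-∷ : ¬ Matchable B A → (∀ {b} → b ∈ B → ¬ Tradable b α) → ¬ Matchable B (α ∷ A)
¬Matchable-∷ nm untradable (b , a , b∈ , here refl , t) = untradable b∈ t
¬Matchable-∷ nm untradable (b , a , b∈ , there a∈ , t) = nm (b , a , b∈ , a∈ , t)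

MatchableOutcome : OrderSet × OrderSet × List Transaction → Set
MatchableOutcome (B̂ , Â , _) = Matchable B̂ Â

matchAsk′-¬Matchable : ∀ n B A α → length B ≤ n → ¬ Matchable B A →
                       ¬ MatchableOutcome (matchAsk′ n B A α)
matchAsk′-¬Matchable n [] A α _ _ (_ , _ , () , _)
matchAsk′-¬Matchable zero (x ∷ xs) A α () _
matchAsk′-¬Matchable (suc n) (x ∷ xs) A α (s≤s len≤n) nm
  with best x xs | best-∈ x xs | best-maximal x xs
... | β | β∈ | maximal with price α ≤? price β
...   | no pα≰pβ = ¬Matchable-∷ nm (λ b∈ pα≤pb → pα≰pβ (≤-trans pα≤pb (maximal b∈)))
...   | yes _ with <-cmp (qty β) (qty α)
...     | tri≈ _ _ _ = nm ∘ Matchable-dominated (remove-dominated (x ∷ xs))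
...     | tri> _ _ _ = nm ∘ Matchable-dominated (partialFill-dominated (x ∷ xs) _ β∈)
...     | tri< _ _ _
  with matchAsk′ n (remove β (x ∷ xs)) A (record α { qty = qty α ∸ qty β })
     | matchAsk′-¬Matchable n (remove β (x ∷ xs)) A (record α { qty = qty α ∸ qty β })
         (≤-trans (≤-pred (length-remove< (x ∷ xs) β∈)) len≤n)
         (nm ∘ Matchable-dominated (remove-dominated (x ∷ xs)))
...       | _ , _ , _ | ih = ih

lemmaA1 : (B A : OrderSet) (α : Order) (B̂ Â : OrderSet) (M : List Transaction) →
    All (λ o → qty o > 0) (B ++ α ∷ A) →
    Admissible B (α ∷ A) →
    matchAsk B A α ≡ (B̂ , Â , M) →
    ¬ Matchable B A →
    ¬ Matchable B̂ Â
lemmaA1 B A α B̂ Â M _ _ eq nm =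
  subst (¬_ ∘ MatchableOutcome) eq (matchAsk′-¬Matchable (length B) B A α ≤-refl nm)
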